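{- Let $k\ge 4$. Let $G_k=(X_k,\mathscr{M}_k)$ be the $k$-graph with $X_k=\{v_1,\dots,v_{2k-1}\}$ and $\mathscr{M}_k=\{M_i=\{v_i,v_{i+1},\dots,v_{i+k-1}\}: i\in\{1,\dots,k\}\}$, and let $G^*_k=(X_k\cup\{x\},\ \mathscr{M}_k\cup\{M^*\})$ where $x\notin X_k$ and $M^*=\{x,v_1,\dots,v_{k-2},v_{k+2}\}$. Then (1) $G^*_k$ is asymmetric, and (2) every non-trivial sub-$k$-graph of $G^*_k$ has an involution.
   Context: A $k$-graph is a pair $(X,\mathscr{M})$ with $X$ finite and $\mathscr{M}\subseteq\binom{X}{k}$; an automorphism is a bijection $\phi:X\to X$ with $\{\phi(M):M\in\mathscr{M}\}=\mathscr{M}$; asymmetric means the only automorphism is the identity. An involution is a non-identity automorphism $\phi$ with $\phi\circ\phi$ equal to the identity. A sub-$k$-graph of $(X,\mathscr{M})$ is $(X',\mathscr{M}')$ with $X'\subseteq X$, $\mathscr{M}'\subseteq\mathscr{M}$ (each edge of $\mathscr{M}'$ contained in $X'$); it is non-trivial if $1<|X'|<|X|$. -}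

module Defs where

open import Data.Nat using (ℕ; zero; suc; _+_; _*_; _∸_; _≤ᵇ_; _≡ᵇ_; _<_)
open import Data.Bool using (Bool; _∧_; _∨_)
open import Data.Fin using (Fin; zero; suc; toℕ)
open import Data.Fin.Subset using (Subset; _∈_; _⊆_; ∣_∣; ⊤)
open import Data.Fin.Permutation using (Permutation′; _⟨$⟩ʳ_; _⟨$⟩ˡ_)
open import Data.Vec using (tabulate; lookup)
open import Data.Product using (Σ; ∃; _×_)
open import Relation.Nullary using (¬_)
open import Relation.Binary.PropositionalEquality using (_≡_)
open import Function.Bundles using (_⇔_)

record EdgeFamily (n e : ℕ) : Set where
  constructor edges
  field
    edge : Fin e → Subset n

open EdgeFamily public

record SubGraph {n e : ℕ} (E : EdgeFamily n e) : Set where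
  constructor subgraph
  field
    verts  : Subset n
    chosen : Subset e
    edges⊆ : ∀ i → i ∈ chosen → edge E i ⊆ verts

open SubGraph public

whole : ∀ {n e} (E : EdgeFamily n e) → SubGraph E
whole E = subgraph ⊤ ⊤ (λ i _ {v} _ → Data.Fin.Subset.Properties.∈⊤)
  where import Data.Fin.Subset.Properties

_∈E_ : ∀ {n e} {E : EdgeFamily n e} → Subset n → SubGraph E → Set
_∈E_ {E = E} S H = ∃ λ i → i ∈ chosen H × edge E i ≡ S

image : ∀ {n} → Permutation′ n → Subset n → Subset n
image π S = tabulate (λ j → lookup S (π ⟨$⟩ˡ j))

-- A bijection of X' is encoded as a
-- permutation of Fin n fixing every vertex outside X'
-- (extension by the identity; this is a one-to-one correspondence).
record Automorphism {n e} {E : EdgeFamily n e} (H : SubGraph E) : Set where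
  constructor automorphism
  field
    perm     : Permutation′ n
    fixOut   : ∀ v → ¬ (v ∈ verts H) → perm ⟨$⟩ʳ v ≡ v
    preserve : ∀ (S : Subset n) → (S ∈E H) ⇔ (image perm S ∈E H)

open Automorphism public

IsIdentity : ∀ {n e} {E : EdgeFamily n e} {H : SubGraph E} → Automorphism H → Set
IsIdentity φ = ∀ v → perm φ ⟨$⟩ʳ v ≡ v

Asymmetric : ∀ {n e} {E : EdgeFamily n e} → SubGraph E → Set
Asymmetric H = ∀ (φ : Automorphism H) → IsIdentity φ

IsInvolution : ∀ {n e} {E : EdgeFamily n e} {H : SubGraph E} → Automorphism H → Set
IsInvolution φ = ¬ IsIdentity φ × (∀ v → perm φ ⟨$⟩ʳ (perm φ ⟨$⟩ʳ v) ≡ v)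

HasInvolution : ∀ {n e} {E : EdgeFamily n e} → SubGraph E → Set
HasInvolution H = Σ (Automorphism H) IsInvolution

NonTrivial : ∀ {n e} {E : EdgeFamily n e} → SubGraph E → Set
NonTrivial {n} H = 1 < ∣ verts H ∣ × ∣ verts H ∣ < n

-- Vertex set Fin (2k): vertex 0 is x, vertex j (1 ≤ j ≤ 2k-1) is v_j.
-- Edge 0 is M* = {x, v_1, ..., v_{k-2}, v_{k+2}};
-- edge (suc i), i : Fin k, is M_{i+1} = {v_{i+1}, ..., v_{i+k}}.

inMi : (k i j : ℕ) → Bool
inMi k i j = (i ≤ᵇ j) ∧ (j ≤ᵇ (i + k ∸ 1))

inM* : (k j : ℕ) → Bool
inM* k j = (j ≡ᵇ 0) ∨ (((1 ≤ᵇ j) ∧ (j ≤ᵇ (k ∸ 2))) ∨ (j ≡ᵇ (k + 2)))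

Gstar-edge : (k : ℕ) → Fin (suc k) → Subset (2 * k)
Gstar-edge k zero    = tabulate (λ j → inM* k (toℕ j))
Gstar-edge k (suc i) = tabulate (λ j → inMi k (suc (toℕ i)) (toℕ j))

Gstar : (k : ℕ) → EdgeFamily (2 * k) (suc k)
Gstar k = edges (Gstar-edge k)

module Submission where

-- An automorphism permutes the edges. The vertex v_k lies in every interval M_i, and v_{2k-1}
-- in M_k alone; where their images can lie forces M* and M_k to be fixed. Descending from M_k,
-- each M_i is fixed too: the image of the last vertex of M_i lies in M_k and in the image of M_i,
-- and the intervals through a vertex form a contiguous range. The intervals separate vertices,
-- so the automorphism is the identity.
-- In a non-trivial sub-k-graph, either two vertices lie in exactly the same kept edges (swap
-- them), or the kept edges are exactly M_1, …, M_k and v_j ↦ v_{2k-j} is an involution; keeping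
-- M*, M_1 and M_k would force every vertex into the sub-k-graph.

open import Defs
open import Data.Bool using (Bool; true; false)
open import Data.Bool.Properties using (T-≡; T-∧; ⇔→≡; ∧-zeroʳ)
open import Data.Fin using (Fin; zero; suc; toℕ; fromℕ; fromℕ<; inject₁; opposite)
open import Data.Fin.Induction using (>-wellFounded)
import Induction.WellFounded as WF
open import Data.Fin.Permutation using (Permutation′; _⟨$⟩ʳ_; _⟨$⟩ˡ_; permutation; flip; inverseˡ)
import Data.Fin.Permutation.Components as PC
import Data.Fin.Properties as Finₚ
open Finₚ using (toℕ-injective; toℕ-fromℕ; toℕ-fromℕ<; toℕ<n; opposite-prop; opposite-involutive; any?; all?; ¬∀⟶∃¬)
open import Data.Fin.Subset using (Subset; _∈_; _∉_; ∣_∣; ⊤; inside; outside; Nonempty)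
open import Data.Fin.Subset.Properties using (∈⊤; p⊆q⇒∣p∣≤∣q∣; ∣⊤∣≡n; nonempty?; Empty-unique; ∣⊥∣≡0; _∈?_)
open import Data.Nat using (ℕ; zero; suc; _+_; _*_; _∸_; _≤_; _<_; _≤ᵇ_; _≡ᵇ_; z≤n; s≤s)
open import Data.Nat.Properties
open import Data.Product using (∃; _×_; _,_; proj₁; proj₂)
open import Data.Sum using (_⊎_; inj₁; inj₂)
open import Data.Vec using (_∷_; lookup; here; there)
open import Data.Vec.Properties using (lookup∘tabulate; tabulate∘lookup; tabulate-cong; lookup⇒[]=)
open import Function using (_∘_)
open import Function.Bundles using (_⇔_; mk⇔; Equivalence)
open import Relation.Binary.Definitions using (tri<; tri≈; tri>)
open import Relation.Binary.PropositionalEquality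
open import Relation.Nullary using (¬_; Dec; yes; no; contradiction)
open import Relation.Nullary.Decidable using (dec-true; dec-false)

m+n≡o+p∧m≤o⇒p≤n : ∀ {m n o p} → m + n ≡ o + p → m ≤ o → p ≤ n
m+n≡o+p∧m≤o⇒p≤n {m} {n} {o} {p} eq m≤o =
  +-cancelˡ-≤ o p n (≤-trans (≤-reflexive (sym eq)) (+-monoˡ-≤ n m≤o))

true≢false : true ≢ false
true≢false ()

≤ᵇ-true : ∀ {m n} → m ≤ n → (m ≤ᵇ n) ≡ true
≤ᵇ-true m≤n = Equivalence.to T-≡ (≤⇒≤ᵇ m≤n)

≤ᵇ-false : ∀ {m n} → n < m → (m ≤ᵇ n) ≡ false
≤ᵇ-false {m} {n} n<m with m ≤ᵇ n in eq
... | true  = contradiction (≤ᵇ⇒≤ m n (Equivalence.from T-≡ eq)) (<⇒≱ n<m)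
... | false = refl

≡ᵇ-false : ∀ {m n} → m ≢ n → (m ≡ᵇ n) ≡ false
≡ᵇ-false {m} {n} m≢n with m ≡ᵇ n in eq
... | true  = contradiction (≡ᵇ⇒≡ m n (Equivalence.from T-≡ eq)) m≢n
... | false = refl

toℕ+toℕ-opposite : ∀ {n} (i : Fin n) → suc (toℕ i + toℕ (opposite i)) ≡ n
toℕ+toℕ-opposite {n} i = trans (cong (λ t → suc (toℕ i) + t) (opposite-prop i)) (m+[n∸m]≡n (toℕ<n i))

reflect : ∀ {n} → Fin (suc n) → Fin (suc n)
reflect zero    = zero
reflect (suc i) = suc (opposite i)

reflect-involutive : ∀ {n} (i : Fin (suc n)) → reflect (reflect i) ≡ i
reflect-involutive zero    = refl
reflect-involutive (suc i) = cong suc (opposite-involutive i)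

all-but-one : ∀ {n} {P : Fin n → Set} {m} (i j : Fin n) → i ≢ j →
              (∀ l → l ≢ m → P l) → P i ⊎ P j
all-but-one {m = m} i j i≢j h with i Finₚ.≟ m
... | yes refl = inj₂ (h j (i≢j ∘ sym))
... | no i≢m   = inj₁ (h i i≢m)

0<∣p∣⇒Nonempty : ∀ {n} (p : Subset n) → 0 < ∣ p ∣ → Nonempty p
0<∣p∣⇒Nonempty {n} p 0<∣p∣ with nonempty? p
... | yes ne = ne
... | no ¬ne = contradiction (trans (cong ∣_∣ (Empty-unique ¬ne)) (∣⊥∣≡0 n)) (>⇒≢ 0<∣p∣)

two-distinct : ∀ {n} (p : Subset n) → 1 < ∣ p ∣ → ∃ λ u → ∃ λ w → u ∈ p × w ∈ p × u ≢ w
two-distinct (inside ∷ p) (s≤s 0<∣p∣) =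
  let w , w∈p = 0<∣p∣⇒Nonempty p 0<∣p∣ in zero , suc w , here , there w∈p , λ ()
two-distinct (outside ∷ p) 1<∣p∣ =
  let u , w , u∈p , w∈p , u≢w = two-distinct p 1<∣p∣
  in suc u , suc w , there u∈p , there w∈p , u≢w ∘ Finₚ.suc-injective

∣p∣<n⇒¬∀∈ : ∀ {n} (p : Subset n) → ∣ p ∣ < n → ¬ (∀ v → v ∈ p)
∣p∣<n⇒¬∀∈ {n} p ∣p∣<n all∈ =
  <⇒≱ ∣p∣<n (subst (_≤ ∣ p ∣) (∣⊤∣≡n n) (p⊆q⇒∣p∣≤∣q∣ {p = ⊤} {q = p} (λ {v} _ → all∈ v)))

transpose-matchˡ : ∀ {n} (u w : Fin n) → PC.transpose u w u ≡ w
transpose-matchˡ u w rewrite dec-true (u Finₚ.≟ u) refl = refl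

transpose-matchʳ : ∀ {n} (u w : Fin n) → PC.transpose u w w ≡ u
transpose-matchʳ u w with w Finₚ.≟ u
... | yes refl = refl
... | no _ rewrite dec-true (w Finₚ.≟ w) refl = refl

transpose-other : ∀ {n} {u w v : Fin n} → v ≢ u → v ≢ w → PC.transpose u w v ≡ v
transpose-other {u = u} {w} {v} v≢u v≢w
  rewrite dec-false (v Finₚ.≟ u) v≢u | dec-false (v Finₚ.≟ w) v≢w = refl

transpose-involutive : ∀ {n} (u w v : Fin n) → PC.transpose u w (PC.transpose u w v) ≡ v
transpose-involutive u w v = cases (v Finₚ.≟ u) (v Finₚ.≟ w)
  where
  t = PC.transpose u w
  cases : Dec (v ≡ u) → Dec (v ≡ w) → t (t v) ≡ v
  cases (yes v≡u) _ = trans (cong (t ∘ t) v≡u)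
                        (trans (cong t (transpose-matchˡ u w)) (trans (transpose-matchʳ u w) (sym v≡u)))
  cases (no _) (yes v≡w) = trans (cong (t ∘ t) v≡w)
                        (trans (cong t (transpose-matchʳ u w)) (trans (transpose-matchˡ u w) (sym v≡w)))
  cases (no v≢u) (no v≢w) = trans (cong t (transpose-other v≢u v≢w)) (transpose-other v≢u v≢w)

∘-transpose : ∀ {n} {A : Set} (f : Fin n → A) {u w} → f u ≡ f w → ∀ v → f (PC.transpose u w v) ≡ f v
∘-transpose f {u} {w} fu≡fw v = cases (v Finₚ.≟ u) (v Finₚ.≟ w)
  where
  cases : Dec (v ≡ u) → Dec (v ≡ w) → f (PC.transpose u w v) ≡ f v
  cases (yes v≡u) _ = trans (cong (f ∘ PC.transpose u w) v≡u)
                        (trans (cong f (transpose-matchˡ u w)) (trans (sym fu≡fw) (cong f (sym v≡u))))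
  cases (no _) (yes v≡w) = trans (cong (f ∘ PC.transpose u w) v≡w)
                        (trans (cong f (transpose-matchʳ u w)) (trans fu≡fw (cong f (sym v≡w))))
  cases (no v≢u) (no v≢w) = cong f (transpose-other v≢u v≢w)

image-≗ : ∀ {n} (π : Permutation′ n) {S T : Subset n} →
          (∀ j → lookup S (π ⟨$⟩ˡ j) ≡ lookup T j) → image π S ≡ T
image-≗ π {T = T} eq = trans (tabulate-cong eq) (tabulate∘lookup T)

lookup-image : ∀ {n} (π : Permutation′ n) (S : Subset n) v → lookup (image π S) (π ⟨$⟩ʳ v) ≡ lookup S v
lookup-image π S v = trans (lookup∘tabulate _ (π ⟨$⟩ʳ v)) (cong (lookup S) (inverseˡ π))

image-flip-image : ∀ {n} (π : Permutation′ n) (S : Subset n) → image π (image (flip π) S) ≡ S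
image-flip-image π S = image-≗ π {image (flip π) S} {S} (lookup-image (flip π) S)

flip-image-image : ∀ {n} (π : Permutation′ n) (S : Subset n) → image (flip π) (image π S) ≡ S
flip-image-image π S = image-≗ (flip π) {image π S} {S} (lookup-image π S)

module _ {n e} {E : EdgeFamily n e} (H : SubGraph E) where

  HasInvolution-intro :
    (s : Fin n → Fin n) → (∀ v → s (s v) ≡ v) →
    (∀ v → v ∉ verts H → s v ≡ v) → (∃ λ v → s v ≢ v) →
    (h : Fin e → Fin e) → (∀ i → i ∈ chosen H → h i ∈ chosen H) →
    (∀ i → i ∈ chosen H → ∀ v → lookup (edge E i) (s v) ≡ lookup (edge E (h i)) v) →
    HasInvolution H
  HasInvolution-intro s s∘s fixes-outside (v , sv≢v) h h-chosen h-edge =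
    automorphism π fixes-outside preserves , (λ id → sv≢v (id v)) , s∘s
    where
    π : Permutation′ n
    π = permutation s s s∘s s∘s

    image-edge : ∀ i → i ∈ chosen H → image π (edge E i) ≡ edge E (h i)
    image-edge i i∈ = image-≗ π {edge E i} {edge E (h i)} (h-edge i i∈)

    preserves : ∀ S → (S ∈E H) ⇔ (image π S ∈E H)
    preserves S = mk⇔
      (λ { (i , i∈ , refl) → h i , h-chosen i i∈ , sym (image-edge i i∈) })
      (λ { (i , i∈ , eq) → h i , h-chosen i i∈ ,
             trans (sym (image-edge i i∈)) (trans (cong (image π) eq) (image-flip-image π S)) })

  twins⇒HasInvolution : ∀ u w → u ∈ verts H → w ∈ verts H → u ≢ w →
    (∀ i → i ∈ chosen H → lookup (edge E i) u ≡ lookup (edge E i) w) → HasInvolution H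
  twins⇒HasInvolution u w u∈ w∈ u≢w twins =
    HasInvolution-intro (PC.transpose u w) (transpose-involutive u w) fixes-outside
      (u , λ tu≡u → u≢w (trans (sym tu≡u) (transpose-matchˡ u w)))
      (λ i → i) (λ _ i∈ → i∈) (λ i i∈ → ∘-transpose (lookup (edge E i)) (twins i i∈))
    where
    fixes-outside : ∀ v → v ∉ verts H → PC.transpose u w v ≡ v
    fixes-outside v v∉ = transpose-other (λ { refl → v∉ u∈ }) (λ { refl → v∉ w∈ })

  edgeless⇒HasInvolution : (∀ i → i ∉ chosen H) → 1 < ∣ verts H ∣ → HasInvolution H
  edgeless⇒HasInvolution edgeless 1<∣X′∣ =
    let u , w , u∈ , w∈ , u≢w = two-distinct (verts H) 1<∣X′∣
    in twins⇒HasInvolution u w u∈ w∈ u≢w (λ i i∈ → contradiction i∈ (edgeless i))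

-- Automorphisms of a k-graph act on its edges

Separating : ∀ {n e} → EdgeFamily n e → Set
Separating E = ∀ u v → (∀ i → lookup (edge E i) u ≡ lookup (edge E i) v) → u ≡ v

module EdgeAction {n e} {E : EdgeFamily n e}
                  (edge-injective : ∀ {i j} → edge E i ≡ edge E j → i ≡ j)
                  (φ : Automorphism (whole E)) where

  π : Permutation′ n
  π = perm φ

  private
    image-edge : ∀ i → image π (edge E i) ∈E whole E
    image-edge i = Equivalence.to (preserve φ (edge E i)) (i , ∈⊤ , refl)

    preimage-edge : ∀ i → image (flip π) (edge E i) ∈E whole E
    preimage-edge i = Equivalence.from (preserve φ (image (flip π) (edge E i)))
                        (i , ∈⊤ , sym (image-flip-image π (edge E i)))

  edgeMap edgeMap⁻¹ : Fin e → Fin e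
  edgeMap   i = proj₁ (image-edge i)
  edgeMap⁻¹ i = proj₁ (preimage-edge i)

  edge-edgeMap : ∀ i → edge E (edgeMap i) ≡ image π (edge E i)
  edge-edgeMap i = proj₂ (proj₂ (image-edge i))

  edge-edgeMap⁻¹ : ∀ i → edge E (edgeMap⁻¹ i) ≡ image (flip π) (edge E i)
  edge-edgeMap⁻¹ i = proj₂ (proj₂ (preimage-edge i))

  lookup-edgeMap : ∀ i v → lookup (edge E (edgeMap i)) (π ⟨$⟩ʳ v) ≡ lookup (edge E i) v
  lookup-edgeMap i v = trans (cong (λ S → lookup S (π ⟨$⟩ʳ v)) (edge-edgeMap i)) (lookup-image π (edge E i) v)

  lookup-edgeMap⁻¹ : ∀ i v → lookup (edge E (edgeMap⁻¹ i)) v ≡ lookup (edge E i) (π ⟨$⟩ʳ v)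
  lookup-edgeMap⁻¹ i v = trans (cong (λ S → lookup S v) (edge-edgeMap⁻¹ i)) (lookup∘tabulate _ v)

  edgeMap-edgeMap⁻¹ : ∀ i → edgeMap (edgeMap⁻¹ i) ≡ i
  edgeMap-edgeMap⁻¹ i = edge-injective (begin
    edge E (edgeMap (edgeMap⁻¹ i))          ≡⟨ edge-edgeMap (edgeMap⁻¹ i) ⟩
    image π (edge E (edgeMap⁻¹ i))          ≡⟨ cong (image π) (edge-edgeMap⁻¹ i) ⟩
    image π (image (flip π) (edge E i))     ≡⟨ image-flip-image π (edge E i) ⟩
    edge E i                                ∎)
    where open ≡-Reasoning

  edgeMap⁻¹-edgeMap : ∀ i → edgeMap⁻¹ (edgeMap i) ≡ i
  edgeMap⁻¹-edgeMap i = edge-injective (begin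
    edge E (edgeMap⁻¹ (edgeMap i))          ≡⟨ edge-edgeMap⁻¹ (edgeMap i) ⟩
    image (flip π) (edge E (edgeMap i))     ≡⟨ cong (image (flip π)) (edge-edgeMap i) ⟩
    image (flip π) (image π (edge E i))     ≡⟨ flip-image-image π (edge E i) ⟩
    edge E i                                ∎)
    where open ≡-Reasoning

  edgeMap-injective : ∀ {i j} → edgeMap i ≡ edgeMap j → i ≡ j
  edgeMap-injective {i} {j} eq =
    trans (sym (edgeMap⁻¹-edgeMap i)) (trans (cong edgeMap⁻¹ eq) (edgeMap⁻¹-edgeMap j))

  edgeMap⁻¹-≢ : ∀ {i j} → i ≢ edgeMap j → edgeMap⁻¹ i ≢ j
  edgeMap⁻¹-≢ {i} i≢ eq = i≢ (trans (sym (edgeMap-edgeMap⁻¹ i)) (cong edgeMap eq))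

  fixes-edges⇒identity : Separating E → (∀ i → edgeMap i ≡ i) → IsIdentity φ
  fixes-edges⇒identity separating fixed v = separating (π ⟨$⟩ʳ v) v λ i →
    trans (cong (λ j → lookup (edge E j) (π ⟨$⟩ʳ v)) (sym (fixed i))) (lookup-edgeMap i v)

module Intervals (k : ℕ) where

  inMi-intro : ∀ {a j} → a < j → j ≤ a + k → inMi k (suc a) j ≡ true
  inMi-intro a<j j≤a+k rewrite ≤ᵇ-true a<j | ≤ᵇ-true j≤a+k = refl

  inMi-elim : ∀ a j → inMi k (suc a) j ≡ true → a < j × j ≤ a + k
  inMi-elim a j j∈ =
    let lo , hi = Equivalence.to T-∧ (Equivalence.from T-≡ j∈)
    in ≤ᵇ⇒≤ (suc a) j lo , ≤ᵇ⇒≤ j (a + k) hi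

  inMi-below : ∀ {a j} → j ≤ a → inMi k (suc a) j ≡ false
  inMi-below j≤a rewrite ≤ᵇ-false (s≤s j≤a) = refl

  inMi-above : ∀ a {j} → a + k < j → inMi k (suc a) j ≡ false
  inMi-above a {j} a+k<j rewrite ≤ᵇ-false a+k<j = ∧-zeroʳ (suc a ≤ᵇ j)

  inMi-top : ∀ {j} → 0 < k → k ≤ j → inMi k (suc (j ∸ k)) j ≡ true
  inMi-top 0<k k≤j = inMi-intro (∸-monoʳ-< 0<k k≤j) (≤-reflexive (sym (m∸n+n≡m k≤j)))

  inMi-between : ∀ {a b d} j → a ≤ b → b ≤ d →
                 inMi k (suc a) j ≡ true → inMi k (suc d) j ≡ true → inMi k (suc b) j ≡ true
  inMi-between {a} {b} {d} j a≤b b≤d j∈a j∈d =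
    inMi-intro (≤-<-trans b≤d (proj₁ (inMi-elim d j j∈d)))
               (≤-trans (proj₂ (inMi-elim a j j∈a)) (+-monoˡ-≤ k a≤b))

  inMi-reflect : ∀ a b j j′ → suc (a + b) ≡ k → j + j′ ≡ k + k →
                 inMi k (suc a) j′ ≡ true → inMi k (suc b) j ≡ true
  inMi-reflect a b j j′ 1+a+b≡k j+j′≡k+k j′∈ =
    let a<j′ , j′≤a+k = inMi-elim a j′ j′∈ in
    inMi-intro (m+n≡o+p∧m≤o⇒p≤n (trans j′+j≡k+k (sym b-side)) j′≤a+k)
               (m+n≡o+p∧m≤o⇒p≤n (trans (1+x+[y+k]≡k+k a b 1+a+b≡k) (sym j′+j≡k+k)) a<j′)
    where
    1+x+[y+k]≡k+k : ∀ x y → suc (x + y) ≡ k → suc x + (y + k) ≡ k + k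
    1+x+[y+k]≡k+k x y 1+x+y≡k = trans (cong suc (sym (+-assoc x y k))) (cong (_+ k) 1+x+y≡k)

    j′+j≡k+k : j′ + j ≡ k + k
    j′+j≡k+k = trans (+-comm j′ j) j+j′≡k+k

    b-side : (a + k) + suc b ≡ k + k
    b-side = trans (+-comm (a + k) (suc b)) (1+x+[y+k]≡k+k b a (trans (cong suc (+-comm b a)) 1+a+b≡k))

  inM*-intro : ∀ {j} → 1 ≤ j → j ≤ k ∸ 2 → inM* k j ≡ true
  inM*-intro {suc j} _ j≤k∸2 rewrite ≤ᵇ-true j≤k∸2 = refl

  inM*-outside : ∀ {j} → k ∸ 2 < j → j ≢ k + 2 → inM* k j ≡ false
  inM*-outside {suc j} k∸2<j j≢k+2 rewrite ≤ᵇ-false k∸2<j | ≡ᵇ-false j≢k+2 = refl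

-- k is written c + 2, so that k ∸ 2 reduces to c and the last interval is fromℕ (suc c).
module GstarProperties (c : ℕ) (2≤c : 2 ≤ c) where

  k : ℕ
  k = 2 + c

  open Intervals k

  0<k : 0 < k
  0<k = s≤s z≤n

  inEdge : Fin (suc k) → ℕ → Bool
  inEdge zero    = inM* k
  inEdge (suc a) = inMi k (suc (toℕ a))

  lookup-Gstar : ∀ i (v : Fin (2 * k)) → lookup (Gstar-edge k i) v ≡ inEdge i (toℕ v)
  lookup-Gstar zero    v = lookup∘tabulate (λ j → inM* k (toℕ j)) v
  lookup-Gstar (suc a) v = lookup∘tabulate (λ j → inMi k (suc (toℕ a)) (toℕ j)) v

  2*k≡k+k : 2 * k ≡ k + k
  2*k≡k+k = cong (k +_) (+-identityʳ k)

  toℕ<k+k : (v : Fin (2 * k)) → toℕ v < k + k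
  toℕ<k+k v = subst (toℕ v <_) 2*k≡k+k (toℕ<n v)

  ≤1+k⇒<k+k : ∀ {j} → j ≤ suc k → j < k + k
  ≤1+k⇒<k+k j≤1+k = ≤-trans (s≤s j≤1+k) (+-monoˡ-≤ k (s≤s (s≤s z≤n)))

  vertex : (j : ℕ) → j < k + k → Fin (2 * k)
  vertex j j<k+k = fromℕ< (subst (j <_) (sym 2*k≡k+k) j<k+k)

  toℕ-vertex : ∀ {j} (j<k+k : j < k + k) → toℕ (vertex j j<k+k) ≡ j
  toℕ-vertex j<k+k = toℕ-fromℕ< _

  lookup-vertex : ∀ i {j} (j<k+k : j < k + k) → lookup (Gstar-edge k i) (vertex j j<k+k) ≡ inEdge i j
  lookup-vertex i j<k+k = trans (lookup-Gstar i _) (cong (inEdge i) (toℕ-vertex j<k+k))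

  last : Fin k
  last = fromℕ (suc c)

  M₁ Mₖ : Fin (suc k)
  M₁ = suc zero
  Mₖ = suc last

  inEdge-Mₖ : ∀ j → inEdge Mₖ j ≡ inMi k k j
  inEdge-Mₖ j = cong (λ t → inMi k (suc t) j) (toℕ-fromℕ (suc c))

  toℕ≤1+c : (a : Fin k) → toℕ a ≤ suc c
  toℕ≤1+c a = ≤-pred (toℕ<n a)

  ≢last⇒toℕ≤c : (a : Fin k) → a ≢ last → toℕ a ≤ c
  ≢last⇒toℕ≤c a a≢last =
    ≤-pred (≤∧≢⇒< (toℕ≤1+c a) (λ a≡1+c → a≢last (toℕ-injective (trans a≡1+c (sym (toℕ-fromℕ (suc c)))))))

  ≢zero⇒1≤toℕ : (a : Fin k) → a ≢ zero → 1 ≤ toℕ a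
  ≢zero⇒1≤toℕ zero    a≢0 = contradiction refl a≢0
  ≢zero⇒1≤toℕ (suc a) _   = s≤s z≤n

  interval : (a : ℕ) → a ≤ suc c → Fin k
  interval a a≤1+c = fromℕ< (s≤s a≤1+c)

  inEdge-interval : ∀ {a} (a≤1+c : a ≤ suc c) j → inEdge (suc (interval a a≤1+c)) j ≡ inMi k (suc a) j
  inEdge-interval a≤1+c j = cong (λ t → inMi k (suc t) j) (toℕ-fromℕ< _)

  k∈intervals : ∀ i → i ≢ zero → inEdge i k ≡ true
  k∈intervals zero    0≢0 = contradiction refl 0≢0
  k∈intervals (suc a) _   = inMi-intro (s≤s (toℕ≤1+c a)) (m≤n+m k (toℕ a))

  top∈interval : (a : Fin k) → inEdge (suc a) (toℕ a + k) ≡ true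
  top∈interval a = inMi-intro (m<m+n (toℕ a) 0<k) ≤-refl

  top∈Mₖ : (a : Fin k) → inEdge Mₖ (toℕ a + k) ≡ true
  top∈Mₖ a = trans (inEdge-Mₖ (toℕ a + k)) (inMi-intro (m≤n+m k (toℕ a)) (+-monoˡ-≤ k (toℕ≤1+c a)))

  top-of-Mₖ-only-in-Mₖ : ∀ i → i ≢ Mₖ → inEdge i (toℕ last + k) ≡ false
  top-of-Mₖ-only-in-Mₖ zero _ rewrite toℕ-fromℕ c =
    inM*-outside (<-≤-trans (n<1+n c) (m≤m+n (suc c) k))
                 (>⇒≢ (subst (_< suc c + k) (+-comm 2 k) (+-monoˡ-< k (s≤s 2≤c))))
  top-of-Mₖ-only-in-Mₖ (suc a) a≢last rewrite toℕ-fromℕ c =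
    inMi-above (toℕ a) (+-monoˡ-< k (s≤s (≢last⇒toℕ≤c a (a≢last ∘ cong suc))))

  inEdge-cong : ∀ i i′ → Gstar-edge k i ≡ Gstar-edge k i′ →
                ∀ {j} (j<k+k : j < k + k) → inEdge i j ≡ inEdge i′ j
  inEdge-cong i i′ eq j<k+k =
    trans (sym (lookup-vertex i j<k+k)) (trans (cong (λ S → lookup S (vertex _ j<k+k)) eq) (lookup-vertex i′ j<k+k))

  -- The first vertex v_{a+1} of M_{a+1} is not in M_{b+1}.
  intervals-differ : ∀ {a b : Fin k} → toℕ a < toℕ b → Gstar-edge k (suc a) ≢ Gstar-edge k (suc b)
  intervals-differ {a} {b} a<b eq = true≢false (begin
    true                            ≡⟨ sym (inMi-intro (n<1+n (toℕ a)) (m<m+n (toℕ a) 0<k)) ⟩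
    inEdge (suc a) (suc (toℕ a))    ≡⟨ inEdge-cong (suc a) (suc b) eq (≤1+k⇒<k+k (s≤s (m≤n⇒m≤1+n (toℕ≤1+c a)))) ⟩
    inEdge (suc b) (suc (toℕ a))    ≡⟨ inMi-below a<b ⟩
    false                           ∎)
    where open ≡-Reasoning

  Gstar-edge-injective : ∀ {i j} → Gstar-edge k i ≡ Gstar-edge k j → i ≡ j
  Gstar-edge-injective {zero}  {zero}  _  = refl
  Gstar-edge-injective {zero}  {suc b} eq = contradiction (inEdge-cong zero (suc b) eq (s≤s z≤n)) true≢false
  Gstar-edge-injective {suc a} {zero}  eq = contradiction (sym (inEdge-cong (suc a) zero eq (s≤s z≤n))) true≢false
  Gstar-edge-injective {suc a} {suc b} eq with <-cmp (toℕ a) (toℕ b)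
  ... | tri< a<b _ _ = contradiction eq (intervals-differ a<b)
  ... | tri≈ _ a≡b _ = cong suc (toℕ-injective a≡b)
  ... | tri> _ _ b<a = contradiction (sym eq) (intervals-differ b<a)

  ∸k≤1+c : ∀ {j} → j < k + k → j ∸ k ≤ suc c
  ∸k≤1+c {j} j<k+k = ≤-pred (m<n+o⇒m∸n<o j k j<k+k)

  -- For u < w the separating interval ends at u (if k ≤ u), starts just after u (if w ≤ u + k),
  -- or else ends at w.
  intervals-separate< : ∀ {u w} → u < w → w < k + k →
                        ¬ (∀ a → a ≤ suc c → inMi k (suc a) u ≡ inMi k (suc a) w)
  intervals-separate< {u} {w} u<w w<k+k same with k ≤? u
  ... | yes k≤u = true≢false (begin
    true                            ≡⟨ sym (inMi-top 0<k k≤u) ⟩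
    inMi k (suc (u ∸ k)) u          ≡⟨ same (u ∸ k) (∸k≤1+c (<-trans u<w w<k+k)) ⟩
    inMi k (suc (u ∸ k)) w          ≡⟨ inMi-above (u ∸ k) (subst (_< w) (sym (m∸n+n≡m k≤u)) u<w) ⟩
    false                           ∎)
    where open ≡-Reasoning
  ... | no k≰u with w ≤? u + k
  ...   | yes w≤u+k = true≢false (begin
    true                            ≡⟨ sym (inMi-intro u<w w≤u+k) ⟩
    inMi k (suc u) w                ≡⟨ sym (same u (≤-pred (≰⇒> k≰u))) ⟩
    inMi k (suc u) u                ≡⟨ inMi-below (≤-refl {u}) ⟩
    false                           ∎)
    where open ≡-Reasoning
  ...   | no w≰u+k = true≢false (begin
    true                            ≡⟨ sym (inMi-top 0<k k≤w) ⟩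
    inMi k (suc (w ∸ k)) w          ≡⟨ sym (same (w ∸ k) (∸k≤1+c w<k+k)) ⟩
    inMi k (suc (w ∸ k)) u          ≡⟨ inMi-below (m+n≤o⇒m≤o∸n u (<⇒≤ u+k<w)) ⟩
    false                           ∎)
    where
    open ≡-Reasoning
    u+k<w : u + k < w
    u+k<w = ≰⇒> w≰u+k
    k≤w : k ≤ w
    k≤w = ≤-trans (m≤n+m k u) (<⇒≤ u+k<w)

  intervals-separate : ∀ {u w} → u < k + k → w < k + k →
                       (∀ a → a ≤ suc c → inMi k (suc a) u ≡ inMi k (suc a) w) → u ≡ w
  intervals-separate {u} {w} u<k+k w<k+k same with <-cmp u w
  ... | tri< u<w _ _ = contradiction same (intervals-separate< u<w w<k+k)
  ... | tri≈ _ u≡w _ = u≡w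
  ... | tri> _ _ w<u = contradiction (λ a a≤1+c → sym (same a a≤1+c)) (intervals-separate< w<u u<k+k)

  Gstar-separating : Separating (Gstar k)
  Gstar-separating u w same =
    toℕ-injective (intervals-separate (toℕ<k+k u) (toℕ<k+k w) λ a a≤1+c →
      let i = suc (interval a a≤1+c) in begin
      inMi k (suc a) (toℕ u)     ≡⟨ sym (inEdge-interval a≤1+c (toℕ u)) ⟩
      inEdge i (toℕ u)           ≡⟨ sym (lookup-Gstar i u) ⟩
      lookup (Gstar-edge k i) u  ≡⟨ same i ⟩
      lookup (Gstar-edge k i) w  ≡⟨ lookup-Gstar i w ⟩
      inEdge i (toℕ w)           ≡⟨ inEdge-interval a≤1+c (toℕ w) ⟩
      inMi k (suc a) (toℕ w)     ∎)
    where open ≡-Reasoning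

  -- Such a vertex would lie in M₁ or M₂ and in M_{k-1} or Mₖ, i.e. among v_{k-1}, vₖ, v_{k+1}, which avoid M*.
  no-vertex-in-all-edges-but-an-interval : ∀ w (a : Fin k) → ¬ (∀ i → i ≢ suc a → inEdge i w ≡ true)
  no-vertex-in-all-edges-but-an-interval w a in-others =
    true≢false (trans (sym (in-others zero λ ())) (inM*-outside c<w (<⇒≢ w<k+2)))
    where
    Mₖ₋₁ : Fin (suc k)
    Mₖ₋₁ = suc (interval c (n≤1+n c))

    one-of : (i j : Fin (suc k)) → i ≢ j → inEdge i w ≡ true ⊎ inEdge j w ≡ true
    one-of i j i≢j = all-but-one {P = λ i → inEdge i w ≡ true} i j i≢j in-others

    w<k+2 : w < k + 2
    w<k+2 with one-of M₁ (suc (suc zero)) (λ ())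
    ... | inj₁ w∈M₁ = subst (w <_) (+-comm 2 k) (s≤s (m≤n⇒m≤1+n (proj₂ (inMi-elim 0 w w∈M₁))))
    ... | inj₂ w∈M₂ = subst (w <_) (+-comm 2 k) (s≤s (proj₂ (inMi-elim 1 w w∈M₂)))

    Mₖ₋₁≢Mₖ : Mₖ₋₁ ≢ Mₖ
    Mₖ₋₁≢Mₖ eq = 1+n≢n (sym (begin
      c                                  ≡⟨ sym (toℕ-fromℕ< _) ⟩
      toℕ (interval c (n≤1+n c))         ≡⟨ cong toℕ (Finₚ.suc-injective eq) ⟩
      toℕ last                           ≡⟨ toℕ-fromℕ (suc c) ⟩
      suc c                              ∎))
      where open ≡-Reasoning

    c<w : c < w
    c<w with one-of Mₖ₋₁ Mₖ Mₖ₋₁≢Mₖ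
    ... | inj₁ w∈Mₖ₋₁ = proj₁ (inMi-elim c w (trans (sym (inEdge-interval (n≤1+n c) w)) w∈Mₖ₋₁))
    ... | inj₂ w∈Mₖ   = <-trans (n<1+n c) (proj₁ (inMi-elim (suc c) w (trans (sym (inEdge-Mₖ w)) w∈Mₖ)))

  first-of-interval-in-another-edge : ∀ (a : Fin k) → ∃ λ i → i ≢ suc a × inEdge i (suc (toℕ a)) ≡ true
  first-of-interval-in-another-edge zero    = zero , (λ ()) , inM*-intro ≤-refl (≤-trans (s≤s z≤n) 2≤c)
  first-of-interval-in-another-edge (suc a) =
    suc (inject₁ a) , (λ eq → 1+n≢n (sym (trans (sym (Finₚ.toℕ-inject₁ a)) (cong toℕ (Finₚ.suc-injective eq))))) ,
    subst (λ t → inMi k (suc t) (suc (suc (toℕ a))) ≡ true) (sym (Finₚ.toℕ-inject₁ a))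
      (inMi-intro (m<n⇒m<1+n (n<1+n (toℕ a))) (≤-trans (≤-reflexive (+-comm 2 (toℕ a))) (+-monoʳ-≤ (toℕ a) (s≤s (s≤s z≤n)))))

  -- A vertex of M_{a+1} other than v_{a+1} is in M_{a+2}; v_{a+1} itself is in M_a or in M*.
  in-interval⇒in-another-edge : ∀ w (a : Fin k) → a ≢ last → inEdge (suc a) w ≡ true →
                                 ∃ λ i → i ≢ suc a × inEdge i w ≡ true
  in-interval⇒in-another-edge w a a≢last w∈ with suc (toℕ a) <? w
  ... | yes 1+a<w = suc next , (λ eq → 1+n≢n (trans (sym (toℕ-fromℕ< next<k)) (cong toℕ (Finₚ.suc-injective eq)))) ,
                    trans (inEdge-interval next≤1+c w) (inMi-intro 1+a<w (m≤n⇒m≤1+n (proj₂ (inMi-elim (toℕ a) w w∈))))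
    where
    next≤1+c : suc (toℕ a) ≤ suc c
    next≤1+c = s≤s (≢last⇒toℕ≤c a a≢last)
    next<k : suc (toℕ a) < k
    next<k = s≤s next≤1+c
    next : Fin k
    next = interval (suc (toℕ a)) next≤1+c
  ... | no 1+a≮w = subst (λ j → ∃ λ i → i ≢ suc a × inEdge i j ≡ true)
                         (sym (≤-antisym (≮⇒≥ 1+a≮w) (proj₁ (inMi-elim (toℕ a) w w∈))))
                         (first-of-interval-in-another-edge a)

  only-in-an-interval⇒last : ∀ w (a : Fin k) → inEdge (suc a) w ≡ true →
                             (∀ i → i ≢ suc a → inEdge i w ≡ false) → a ≡ last
  only-in-an-interval⇒last w a w∈ w∉ with a Finₚ.≟ last
  ... | yes a≡last = a≡last
  ... | no a≢last with in-interval⇒in-another-edge w a a≢last w∈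
  ...   | i , i≢ , w∈i = contradiction (trans (sym w∈i) (w∉ i i≢)) true≢false

  module Rigidity (φ : Automorphism (whole (Gstar k))) where
    open EdgeAction Gstar-edge-injective φ

    ψ : Fin (2 * k) → ℕ
    ψ v = toℕ (π ⟨$⟩ʳ v)

    inEdge-edgeMap : ∀ i v → inEdge (edgeMap i) (ψ v) ≡ inEdge i (toℕ v)
    inEdge-edgeMap i v =
      trans (sym (lookup-Gstar (edgeMap i) (π ⟨$⟩ʳ v))) (trans (lookup-edgeMap i v) (lookup-Gstar i v))

    inEdge-edgeMap⁻¹ : ∀ i v → inEdge (edgeMap⁻¹ i) (toℕ v) ≡ inEdge i (ψ v)
    inEdge-edgeMap⁻¹ i v =
      trans (sym (lookup-Gstar (edgeMap⁻¹ i) v)) (trans (lookup-edgeMap⁻¹ i v) (lookup-Gstar i (π ⟨$⟩ʳ v)))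

    inEdge-vertex : ∀ i {j} (j<k+k : j < k + k) → inEdge i (toℕ (vertex j j<k+k)) ≡ inEdge i j
    inEdge-vertex i j<k+k = cong (inEdge i) (toℕ-vertex j<k+k)

    top : Fin k → Fin (2 * k)
    top a = vertex (toℕ a + k) (+-monoˡ-< k (toℕ<n a))

    inEdge-top : ∀ i a → inEdge i (toℕ (top a)) ≡ inEdge i (toℕ a + k)
    inEdge-top i a = inEdge-vertex i (+-monoˡ-< k (toℕ<n a))

    -- vₖ lies in every interval, so ψ vₖ lies in every edge but the image of M*.
    edgeMap-M* : edgeMap zero ≡ zero
    edgeMap-M* with edgeMap zero in eq
    ... | zero  = refl
    ... | suc a = contradiction in-others (no-vertex-in-all-edges-but-an-interval (ψ vₖ) a)
      where
      k<k+k : k < k + k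
      k<k+k = ≤1+k⇒<k+k (n≤1+n k)

      vₖ : Fin (2 * k)
      vₖ = vertex k k<k+k

      in-others : ∀ i → i ≢ suc a → inEdge i (ψ vₖ) ≡ true
      in-others i i≢ = begin
        inEdge i (ψ vₖ)                ≡⟨ sym (inEdge-edgeMap⁻¹ i vₖ) ⟩
        inEdge (edgeMap⁻¹ i) (toℕ vₖ)  ≡⟨ inEdge-vertex (edgeMap⁻¹ i) k<k+k ⟩
        inEdge (edgeMap⁻¹ i) k         ≡⟨ k∈intervals (edgeMap⁻¹ i) (edgeMap⁻¹-≢ (i≢ ∘ (λ i≡ → trans i≡ eq))) ⟩
        true                           ∎
        where open ≡-Reasoning

    -- The top vertex v_{2k-1} lies in Mₖ only, so ψ v_{2k-1} lies in the image of Mₖ only.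
    edgeMap-Mₖ : edgeMap Mₖ ≡ Mₖ
    edgeMap-Mₖ with edgeMap Mₖ in eq
    ... | zero  = contradiction (edgeMap-injective (trans eq (sym edgeMap-M*))) (λ ())
    ... | suc a = cong suc (only-in-an-interval⇒last (ψ (top last)) a ψtop∈ ψtop∉)
      where
      open ≡-Reasoning

      ψtop∈ : inEdge (suc a) (ψ (top last)) ≡ true
      ψtop∈ = begin
        inEdge (suc a) (ψ (top last))       ≡⟨ cong (λ i → inEdge i (ψ (top last))) (sym eq) ⟩
        inEdge (edgeMap Mₖ) (ψ (top last))  ≡⟨ inEdge-edgeMap Mₖ (top last) ⟩
        inEdge Mₖ (toℕ (top last))          ≡⟨ inEdge-top Mₖ last ⟩
        inEdge Mₖ (toℕ last + k)            ≡⟨ top∈interval last ⟩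
        true                                ∎

      ψtop∉ : ∀ i → i ≢ suc a → inEdge i (ψ (top last)) ≡ false
      ψtop∉ i i≢ = begin
        inEdge i (ψ (top last))                ≡⟨ sym (inEdge-edgeMap⁻¹ i (top last)) ⟩
        inEdge (edgeMap⁻¹ i) (toℕ (top last))  ≡⟨ inEdge-top (edgeMap⁻¹ i) last ⟩
        inEdge (edgeMap⁻¹ i) (toℕ last + k)
          ≡⟨ top-of-Mₖ-only-in-Mₖ (edgeMap⁻¹ i) (edgeMap⁻¹-≢ (i≢ ∘ (λ i≡ → trans i≡ eq))) ⟩
        false                                  ∎

    -- The top vertex of M_{a+1} lies in the preimage of M_{a+1}, which is thus an interval
    -- M_{b+1} with b ≥ a; later intervals are fixed, so b = a.
    edgeMap-interval-if-top-stays : ∀ a → (∀ b → toℕ a < toℕ b → edgeMap (suc b) ≡ suc b) →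
                                    inEdge (suc a) (ψ (top a)) ≡ true → edgeMap (suc a) ≡ suc a
    edgeMap-interval-if-top-stays a IH ψtop∈ with edgeMap⁻¹ (suc a) in eq
    ... | zero  = contradiction eq (edgeMap⁻¹-≢ ((λ ()) ∘ (λ a≡ → trans a≡ edgeMap-M*)))
    ... | suc b with <-cmp (toℕ b) (toℕ a)
    ...   | tri≈ _ b≡a _ = trans (cong edgeMap (sym (trans eq (cong suc (toℕ-injective b≡a))))) (edgeMap-edgeMap⁻¹ (suc a))
    ...   | tri> _ _ a<b = contradiction (cong toℕ (Finₚ.suc-injective b≡a)) (>⇒≢ a<b)
      where
      b≡a : suc b ≡ suc a
      b≡a = trans (sym (IH b a<b)) (trans (cong edgeMap (sym eq)) (edgeMap-edgeMap⁻¹ (suc a)))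
    ...   | tri< b<a _ _ = contradiction (trans (sym top∈b) (inMi-above (toℕ b) (+-monoˡ-< k b<a))) true≢false
      where
      open ≡-Reasoning
      top∈b : inEdge (suc b) (toℕ a + k) ≡ true
      top∈b = begin
        inEdge (suc b) (toℕ a + k)                 ≡⟨ sym (inEdge-top (suc b) a) ⟩
        inEdge (suc b) (toℕ (top a))               ≡⟨ cong (λ i → inEdge i (toℕ (top a))) (sym eq) ⟩
        inEdge (edgeMap⁻¹ (suc a)) (toℕ (top a))   ≡⟨ inEdge-edgeMap⁻¹ (suc a) (top a) ⟩
        inEdge (suc a) (ψ (top a))                 ≡⟨ ψtop∈ ⟩
        true                                       ∎

    -- If M_{a+1} went to an earlier interval M_{a′+1}, then ψ (top of M_{a+1}) would lie in
    -- M_{a′+1} and in Mₖ, hence in M_{a+1}.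
    edgeMap-interval-step : ∀ a → (∀ b → toℕ a < toℕ b → edgeMap (suc b) ≡ suc b) → edgeMap (suc a) ≡ suc a
    edgeMap-interval-step a IH with edgeMap (suc a) in eq
    ... | zero   = contradiction (edgeMap-injective (trans eq (sym edgeMap-M*))) (λ ())
    ... | suc a′ with <-cmp (toℕ a′) (toℕ a)
    ...   | tri≈ _ a′≡a _ = cong suc (toℕ-injective a′≡a)
    ...   | tri> _ _ a<a′ =
      contradiction (cong toℕ (Finₚ.suc-injective (edgeMap-injective (trans eq (sym (IH a′ a<a′)))))) (<⇒≢ a<a′)
    ...   | tri< a′<a _ _ =
      trans (sym eq) (edgeMap-interval-if-top-stays a IH
        (inMi-between (ψ (top a)) (<⇒≤ a′<a) (toℕ≤1+c a) ψtop∈a′ (trans (sym (inEdge-Mₖ (ψ (top a)))) ψtop∈Mₖ)))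
      where
      open ≡-Reasoning
      ψtop∈a′ : inEdge (suc a′) (ψ (top a)) ≡ true
      ψtop∈a′ = begin
        inEdge (suc a′) (ψ (top a))           ≡⟨ cong (λ i → inEdge i (ψ (top a))) (sym eq) ⟩
        inEdge (edgeMap (suc a)) (ψ (top a))  ≡⟨ inEdge-edgeMap (suc a) (top a) ⟩
        inEdge (suc a) (toℕ (top a))          ≡⟨ inEdge-top (suc a) a ⟩
        inEdge (suc a) (toℕ a + k)            ≡⟨ top∈interval a ⟩
        true                                  ∎
      ψtop∈Mₖ : inEdge Mₖ (ψ (top a)) ≡ true
      ψtop∈Mₖ = begin
        inEdge Mₖ (ψ (top a))                 ≡⟨ cong (λ i → inEdge i (ψ (top a))) (sym edgeMap-Mₖ) ⟩
        inEdge (edgeMap Mₖ) (ψ (top a))       ≡⟨ inEdge-edgeMap Mₖ (top a) ⟩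
        inEdge Mₖ (toℕ (top a))               ≡⟨ inEdge-top Mₖ a ⟩
        inEdge Mₖ (toℕ a + k)                 ≡⟨ top∈Mₖ a ⟩
        true                                  ∎

    edgeMap-interval : ∀ a → edgeMap (suc a) ≡ suc a
    edgeMap-interval = WF.All.wfRec >-wellFounded _ (λ a → edgeMap (suc a) ≡ suc a)
                         (λ a IH → edgeMap-interval-step a (λ b a<b → IH a<b))

    edgeMap-fixes-edges : ∀ i → edgeMap i ≡ i
    edgeMap-fixes-edges zero    = edgeMap-M*
    edgeMap-fixes-edges (suc a) = edgeMap-interval a

  Gstar-asymmetric : Asymmetric (whole (Gstar k))
  Gstar-asymmetric φ =
    EdgeAction.fixes-edges⇒identity Gstar-edge-injective φ Gstar-separating (Rigidity.edgeMap-fixes-edges φ)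

  module _ (H : SubGraph (Gstar k)) where

    Covered : ℕ → Set
    Covered j = ∃ λ i → i ∈ chosen H × inEdge i j ≡ true

    covered⇒∈verts : ∀ v → Covered (toℕ v) → v ∈ verts H
    covered⇒∈verts v (i , i∈ , v∈i) =
      edges⊆ H i i∈ (lookup⇒[]= v (Gstar-edge k i) (trans (lookup-Gstar i v) v∈i))

    twins : ∀ {j j′} (j<k+k : j < k + k) (j′<k+k : j′ < k + k) → j ≢ j′ → Covered j → Covered j′ →
            (∀ i → i ∈ chosen H → inEdge i j ≡ inEdge i j′) → HasInvolution H
    twins {j} {j′} j<k+k j′<k+k j≢j′ cov cov′ same =
      twins⇒HasInvolution H u u′
        (covered⇒∈verts u (subst Covered (sym (toℕ-vertex j<k+k)) cov))
        (covered⇒∈verts u′ (subst Covered (sym (toℕ-vertex j′<k+k)) cov′))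
        (λ u≡u′ → j≢j′ (trans (sym (toℕ-vertex j<k+k)) (trans (cong toℕ u≡u′) (toℕ-vertex j′<k+k))))
        (λ i i∈ → trans (lookup-vertex i j<k+k) (trans (same i i∈) (sym (lookup-vertex i j′<k+k))))
      where
      u u′ : Fin (2 * k)
      u  = vertex j j<k+k
      u′ = vertex j′ j′<k+k

    x-v₁-twins : M₁ ∉ chosen H → zero ∈ chosen H → HasInvolution H
    x-v₁-twins M₁∉ M*∈ =
      twins {0} {1} (≤1+k⇒<k+k z≤n) (≤1+k⇒<k+k (s≤s z≤n)) (λ ()) (zero , M*∈ , refl) (zero , M*∈ , 1∈M*) same
      where
      1∈M* : inEdge zero 1 ≡ true
      1∈M* = inM*-intro ≤-refl (≤-trans (s≤s z≤n) 2≤c)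

      same : ∀ i → i ∈ chosen H → inEdge i 0 ≡ inEdge i 1
      same zero    _  = sym 1∈M*
      same (suc a) a∈ = sym (inMi-below (≢zero⇒1≤toℕ a (λ { refl → M₁∉ a∈ })))

    vₖ-vₖ₊₁-twins : zero ∉ chosen H → M₁ ∉ chosen H → ∀ a → suc a ∈ chosen H → HasInvolution H
    vₖ-vₖ₊₁-twins M*∉ M₁∉ a a∈ =
      twins {k} {suc k} (≤1+k⇒<k+k (n≤1+n k)) (≤1+k⇒<k+k ≤-refl) (<⇒≢ (n<1+n k))
            (suc a , a∈ , k∈ a) (suc a , a∈ , 1+k∈ a a∈) same
      where
      k∈ : ∀ b → inEdge (suc b) k ≡ true
      k∈ b = k∈intervals (suc b) (λ ())

      1+k∈ : ∀ b → suc b ∈ chosen H → inEdge (suc b) (suc k) ≡ true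
      1+k∈ b b∈ = inMi-intro (s≤s (m≤n⇒m≤1+n (toℕ≤1+c b)))
                             (+-monoˡ-≤ k (≢zero⇒1≤toℕ b (λ { refl → M₁∉ b∈ })))

      same : ∀ i → i ∈ chosen H → inEdge i k ≡ inEdge i (suc k)
      same zero    M*∈ = contradiction M*∈ M*∉
      same (suc b) b∈  = trans (k∈ b) (sym (1+k∈ b b∈))

    -- Among the intervals only M_{a+1} separates v_a from v_{a+1}; when a = k - 1 neither lies in M*.
    gap-twins : M₁ ∈ chosen H → ∀ a → suc a ∉ chosen H → (zero ∈ chosen H → a ≡ last) → HasInvolution H
    gap-twins M₁∈ a a∉ M*∈⇒last =
      twins {toℕ a} {suc (toℕ a)} (≤1+k⇒<k+k (m≤n⇒m≤1+n (<⇒≤ (toℕ<n a)))) (≤1+k⇒<k+k (m≤n⇒m≤1+n (toℕ<n a)))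
            (<⇒≢ (n<1+n (toℕ a)))
            (M₁ , M₁∈ , inMi-intro (≢zero⇒1≤toℕ a (λ { refl → a∉ M₁∈ })) (<⇒≤ (toℕ<n a)))
            (M₁ , M₁∈ , inMi-intro (s≤s z≤n) (toℕ<n a)) same
      where
      last-outside-M* : inM* k (toℕ last) ≡ inM* k (suc (toℕ last))
      last-outside-M* rewrite toℕ-fromℕ c =
        trans (inM*-outside (n<1+n c) (<⇒≢ (<-trans (n<1+n (suc c)) k<k+2)))
              (sym (inM*-outside (<-trans (n<1+n c) (n<1+n (suc c))) (<⇒≢ k<k+2)))
        where
        k<k+2 : k < k + 2
        k<k+2 = m<m+n k (s≤s z≤n)

      same : ∀ i → i ∈ chosen H → inEdge i (toℕ a) ≡ inEdge i (suc (toℕ a))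
      same zero M*∈ = subst (λ b → inM* k (toℕ b) ≡ inM* k (suc (toℕ b))) (sym (M*∈⇒last M*∈)) last-outside-M*
      same (suc b) b∈ with <-cmp (toℕ b) (toℕ a)
      ... | tri< b<a _ _ = trans (inMi-intro b<a (≤-trans (<⇒≤ (toℕ<n a)) (m≤n+m k (toℕ b))))
                                 (sym (inMi-intro (m<n⇒m<1+n b<a) (≤-trans (toℕ<n a) (m≤n+m k (toℕ b)))))
      ... | tri≈ _ b≡a _ = contradiction (subst (λ b → suc b ∈ chosen H) (toℕ-injective b≡a) b∈) a∉
      ... | tri> _ _ a<b = trans (inMi-below (<⇒≤ a<b)) (sym (inMi-below a<b))

    suc∈verts : M₁ ∈ chosen H → Mₖ ∈ chosen H → ∀ v → suc v ∈ verts H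
    suc∈verts M₁∈ Mₖ∈ v = covered⇒∈verts (suc v) covered
      where
      covered : Covered (suc (toℕ v))
      covered with suc (toℕ v) ≤? k
      ... | yes 1+v≤k = M₁ , M₁∈ , inMi-intro (s≤s z≤n) 1+v≤k
      ... | no  1+v≰k = Mₖ , Mₖ∈ , trans (inEdge-Mₖ (suc (toℕ v))) (inMi-intro (<⇒≤ (≰⇒> 1+v≰k)) (≤-pred (toℕ<k+k (suc v))))

    ∀∈verts : zero ∈ chosen H → M₁ ∈ chosen H → Mₖ ∈ chosen H → ∀ v → v ∈ verts H
    ∀∈verts M*∈ M₁∈ Mₖ∈ zero    = covered⇒∈verts zero (zero , M*∈ , refl)
    ∀∈verts M*∈ M₁∈ Mₖ∈ (suc v) = suc∈verts M₁∈ Mₖ∈ v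

    -- reflect mirrors v_j to v_{2k-j} and fixes x; it maps M_{a+1} onto M_{k-a}.
    reflect-edge : ∀ a v → lookup (Gstar-edge k (suc a)) (reflect v) ≡ lookup (Gstar-edge k (reflect (suc a))) v
    reflect-edge a zero    = refl
    reflect-edge a (suc v) = begin
      lookup (Gstar-edge k (suc a)) (suc (opposite v))         ≡⟨ lookup-Gstar (suc a) (suc (opposite v)) ⟩
      inMi k (suc (toℕ a)) (suc (toℕ (opposite v)))            ≡⟨ ⇔→≡ (mk⇔ to from) ⟩
      inMi k (suc (toℕ (opposite a))) (suc (toℕ v))            ≡⟨ sym (lookup-Gstar (suc (opposite a)) (suc v)) ⟩
      lookup (Gstar-edge k (suc (opposite a))) (suc v)         ∎
      where
      open ≡-Reasoning
      j j′ b : ℕ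
      j  = suc (toℕ v)
      j′ = suc (toℕ (opposite v))
      b  = toℕ (opposite a)

      j+j′≡k+k : j + j′ ≡ k + k
      j+j′≡k+k = trans (cong suc (+-suc (toℕ v) (toℕ (opposite v))))
                       (trans (cong suc (toℕ+toℕ-opposite v)) 2*k≡k+k)

      to : inMi k (suc (toℕ a)) j′ ≡ true → inMi k (suc b) j ≡ true
      to = inMi-reflect (toℕ a) b j j′ (toℕ+toℕ-opposite a) j+j′≡k+k

      from : inMi k (suc b) j ≡ true → inMi k (suc (toℕ a)) j′ ≡ true
      from = inMi-reflect b (toℕ a) j′ j (trans (cong suc (+-comm b (toℕ a))) (toℕ+toℕ-opposite a))
                          (trans (+-comm j′ j) j+j′≡k+k)

    reflection : zero ∉ chosen H → (∀ a → suc a ∈ chosen H) → HasInvolution H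
    reflection M*∉ all∈ =
      HasInvolution-intro H reflect reflect-involutive fixes-outside (suc zero , moves-v₁)
        reflect h-chosen h-edge
      where
      fixes-outside : ∀ v → v ∉ verts H → reflect v ≡ v
      fixes-outside zero    _  = refl
      fixes-outside (suc v) v∉ = contradiction (suc∈verts (all∈ zero) (all∈ last) v) v∉

      moves-v₁ : reflect {suc (c + (k + 0))} (suc zero) ≢ suc zero
      moves-v₁ eq with m+n≡0⇒n≡0 c (trans (sym (opposite-prop zero)) (cong toℕ (Finₚ.suc-injective eq)))
      ... | ()

      h-chosen : ∀ i → i ∈ chosen H → reflect i ∈ chosen H
      h-chosen zero    M*∈ = contradiction M*∈ M*∉
      h-chosen (suc a) _   = all∈ (opposite a)

      h-edge : ∀ i → i ∈ chosen H → ∀ v → lookup (Gstar-edge k i) (reflect v) ≡ lookup (Gstar-edge k (reflect i)) v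
      h-edge zero    M*∈ = contradiction M*∈ M*∉
      h-edge (suc a) _   = reflect-edge a

    nontrivial⇒HasInvolution : NonTrivial H → HasInvolution H
    nontrivial⇒HasInvolution (1<∣X′∣ , ∣X′∣<2k) with M₁ ∈? chosen H | zero ∈? chosen H
    ... | no M₁∉ | yes M*∈ = x-v₁-twins M₁∉ M*∈
    ... | no M₁∉ | no M*∉ with any? (λ a → suc a ∈? chosen H)
    ...   | yes (a , a∈) = vₖ-vₖ₊₁-twins M*∉ M₁∉ a a∈
    ...   | no no-interval = edgeless⇒HasInvolution H edgeless 1<∣X′∣
      where
      edgeless : ∀ i → i ∉ chosen H
      edgeless zero    = M*∉
      edgeless (suc a) = no-interval ∘ (a ,_)
    nontrivial⇒HasInvolution (1<∣X′∣ , ∣X′∣<2k) | yes M₁∈ | yes M*∈ with Mₖ ∈? chosen H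
    ...   | yes Mₖ∈ = contradiction (∀∈verts M*∈ M₁∈ Mₖ∈) (∣p∣<n⇒¬∀∈ (verts H) ∣X′∣<2k)
    ...   | no  Mₖ∉ = gap-twins M₁∈ last Mₖ∉ (λ _ → refl)
    nontrivial⇒HasInvolution (1<∣X′∣ , ∣X′∣<2k) | yes M₁∈ | no M*∉ with all? (λ a → suc a ∈? chosen H)
    ...   | yes all∈ = reflection M*∉ all∈
    ...   | no ¬all∈ =
      let a , a∉ = ¬∀⟶∃¬ k _ (λ a → suc a ∈? chosen H) ¬all∈
      in gap-twins M₁∈ a a∉ (λ M*∈ → contradiction M*∈ M*∉)

lemma12 : ∀ (k : ℕ) → 4 ≤ k →
    Asymmetric (whole (Gstar k)) ×
    (∀ (H : SubGraph (Gstar k)) → NonTrivial H → HasInvolution H)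
lemma12 (suc (suc c)) (s≤s (s≤s 2≤c)) = Gstar-asymmetric , nontrivial⇒HasInvolution
  where open GstarProperties c 2≤c
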